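{- $\chi'_{qm\Sigma}(C_5)=5$, and for every $n\ge 3$ with $n\ne 5$, $\chi'_{qm\Sigma}(C_n)=3$ if $n\equiv 0\pmod 3$ and $\chi'_{qm\Sigma}(C_n)=4$ otherwise.
   Context: $C_n$ denotes the cycle on $n$ vertices. A $k$-edge-coloring of a graph $G$ is any map $c:E(G)\to[k]$ (adjacent edges may receive the same color). It induces $\sigma_c(v)=\sum_{u\in N(v)}c(vu)$. The coloring is neighbor sum distinguishing (NSD) if $\sigma_c(u)\ne\sigma_c(v)$ for every edge $uv$, and quasi-majority (QM) if every vertex $v$ is incident to at most $\lceil d(v)/2\rceil$ edges of each color. $\chi'_{qm\Sigma}(G)$ is the minimum $k$ such that $G$ has a QM and NSD $k$-edge-coloring. -}

module Defs where

open import Data.Nat using (ℕ; zero; suc; _+_; _≤_; _<_; _/_; _%_)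
open import Data.Fin using (Fin; toℕ; fromℕ<)
open import Data.Fin.Properties using (_≟_)
open import Data.Vec.Functional using (Vector)
open import Data.Nat.ListAction using (sum)
open import Data.List using (List; map; filter; length; allFin)
open import Data.Product using (_×_; _,_; proj₁; proj₂; Σ; ∃)
open import Data.Sum using (_⊎_)
open import Relation.Binary.PropositionalEquality using (_≡_; _≢_)
open import Relation.Nullary.Decidable using (_⊎-dec_)
open import Data.Nat.DivMod using (m%n<n)
open import Relation.Nullary using (Dec; ¬_)

record Graph : Set where
  field
    n    : ℕ
    m    : ℕ
    ends : Fin m → Fin n × Fin n
open Graph public

Incident : (G : Graph) → Fin (m G) → Fin (n G) → Set
Incident G e v = proj₁ (ends G e) ≡ v ⊎ proj₂ (ends G e) ≡ v

incident? : (G : Graph) → (e : Fin (m G)) → (v : Fin (n G)) →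
            Dec (Incident G e v)
incident? G e v = (proj₁ (ends G e) ≟ v) ⊎-dec (proj₂ (ends G e) ≟ v)

incEdges : (G : Graph) → Fin (n G) → List (Fin (m G))
incEdges G v = filter (λ e → incident? G e v) (allFin (m G))

degree : (G : Graph) → Fin (n G) → ℕ
degree G v = length (incEdges G v)

EdgeColoring : Graph → ℕ → Set
EdgeColoring G k = Σ (Fin (m G) → ℕ) λ c → ∀ e → 1 ≤ c e × c e ≤ k

σ : (G : Graph) → (Fin (m G) → ℕ) → Fin (n G) → ℕ
σ G c v = sum (map c (incEdges G v))

NSD : (G : Graph) → (Fin (m G) → ℕ) → Set
NSD G c = ∀ e → σ G c (proj₁ (ends G e)) ≢ σ G c (proj₂ (ends G e))

colorCount : (G : Graph) → (Fin (m G) → ℕ) → Fin (n G) → ℕ → ℕ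
colorCount G c v a = length (filter (λ e → c e Data.Nat.≟ a) (incEdges G v))

ceilHalf : ℕ → ℕ
ceilHalf d = (d + 1) / 2

QM : (G : Graph) → (Fin (m G) → ℕ) → Set
QM G c = ∀ v a → colorCount G c v a ≤ ceilHalf (degree G v)

HasQMNSD : Graph → ℕ → Set
HasQMNSD G k = Σ (EdgeColoring G k) λ c → QM G (proj₁ c) × NSD G (proj₁ c)

ChiQMSigma≡ : Graph → ℕ → Set
ChiQMSigma≡ G k = HasQMNSD G k × (∀ j → j < k → ¬ HasQMNSD G j)

cycleGraph : (k : ℕ) → Graph
cycleGraph zero = record { n = 0 ; m = 0 ; ends = λ () }
cycleGraph (suc k) = record
  { n = suc k ; m = suc k
  ; ends = λ i → i , fromℕ< (m%n<n (suc (toℕ i)) (suc k)) }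

-- Around a vertex of a cycle the two incident edges are consecutive edges e, e⁺, so on Cₙ
-- the quasi-majority condition says that consecutive edges get different colours, and
-- σ(u) ≠ σ(v) across the edge e = uv says that the two edges flanking e get different
-- colours. A QM and NSD colouring of Cₙ is therefore a cyclic colour sequence in which
-- any three consecutive edges are coloured differently. Three colours are necessary, and
-- with exactly three the sequence is 3-periodic, which forces 3 ∣ n. On C₅ any two edges
-- are at most two steps apart, so all five colours differ. Conversely 123…123 colours C₃ₜ,
-- and prefixing one or two blocks 1234 to it colours C₃ₜ₊₄ and C₃ₜ₊₈ with four colours.
module Submission where

open import Defs
open import Data.Nat
  using (ℕ; zero; suc; _+_; _*_; _%_; _/_; _≤_; _<_; _≟_; z≤n; s≤s; s≤s⁻¹)
open import Data.Nat.Properties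
  using (+-identityʳ; +-comm; +-cancelˡ-≡; 1+n≢n; n≤1+n; ≤-refl; ≤-reflexive; ≤-trans; <⇒≤; <⇒≱; ≰⇒>; _≤?_)
open import Data.Nat.DivMod using (m%n<n; m<n⇒m%n≡m; n%n≡0; m≡m%n+[m/n]*n; m*n%n≡0; [m+kn]%n≡m%n)
open import Data.Nat.ListAction using (sum)
open import Data.Fin as Fin using (Fin; zero; suc; toℕ; fromℕ; fromℕ<; inject₁)
open import Data.Fin.Properties
  using (toℕ-fromℕ; toℕ-fromℕ<; toℕ-inject₁; toℕ-injective; toℕ<n; pigeonhole)
open import Data.List using (List; []; _∷_; length; filter; map; lookup)
open import Data.List.Properties using (filter-accept; filter-reject; filter-none; filter-all; length-filter)
open import Data.List.Membership.Propositional using (_∈_)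
open import Data.List.Membership.Propositional.Properties using (∈-allFin; ∈-lookup)
open import Data.List.Relation.Unary.Any using (here; there)
open import Data.List.Relation.Unary.All as All using ([]; _∷_)
open import Data.List.Relation.Unary.AllPairs using (AllPairs; []; _∷_)
open import Data.List.Relation.Unary.Unique.Propositional using (Unique)
open import Data.List.Relation.Unary.Unique.Propositional.Properties using (allFin⁺)
open import Data.Product using (∃; _×_; _,_; proj₁; proj₂)
open import Data.Sum using (_⊎_; inj₁; inj₂; [_,_]′)
import Data.Sum as Sum
open import Function using (_∘_; _⇔_; mk⇔; Equivalence)
open import Level using (0ℓ)
open import Relation.Nullary using (¬_; Dec; yes; no; contradiction)
open import Relation.Unary using (Pred; Decidable)
open import Relation.Binary using (Rel)
open import Relation.Binary.PropositionalEquality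
  using (_≡_; _≢_; refl; sym; trans; cong; subst; ≢-sym; module ≡-Reasoning)

open Equivalence using (to; from)

module _ {A : Set} {P : Pred A 0ℓ} (P? : Decidable P) where

  filter-≡-singleton : ∀ {x xs} → Unique xs → x ∈ xs → P x →
                       (∀ {z} → z ∈ xs → P z → z ≡ x) → filter P? xs ≡ x ∷ []
  filter-≡-singleton (x∉ ∷ _) (here refl) px only =
    trans (filter-accept P? px)
          (cong (_ ∷_) (filter-none P? (All.tabulate λ z∈ pz → All.lookup x∉ z∈ (sym (only (there z∈) pz)))))
  filter-≡-singleton {x} {z ∷ _} (z∉ ∷ u) (there x∈) px only =
    trans (filter-reject P? ¬pz) (filter-≡-singleton u x∈ px (only ∘ there))
    where
    ¬pz : ¬ P z
    ¬pz pz = All.lookup z∉ x∈ (only (here refl) pz)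

  filter-≡-head-pair : ∀ {x y xs} → Unique (x ∷ xs) → y ∈ xs → P x → P y →
                       (∀ {z} → z ∈ x ∷ xs → P z → z ≡ x ⊎ z ≡ y) →
                       filter P? (x ∷ xs) ≡ x ∷ y ∷ []
  filter-≡-head-pair {x} (x∉ ∷ u) y∈ px py only =
    trans (filter-accept P? px) (cong (x ∷_) (filter-≡-singleton u y∈ py only′))
    where
    only′ : ∀ {z} → z ∈ _ → P z → z ≡ _
    only′ z∈ pz with only (there z∈) pz
    ... | inj₁ refl = contradiction refl (All.lookup x∉ z∈)
    ... | inj₂ z≡y  = z≡y

  filter-≡-pair : ∀ {x y xs} → Unique xs → x ∈ xs → y ∈ xs → x ≢ y → P x → P y →
                  (∀ {z} → z ∈ xs → P z → z ≡ x ⊎ z ≡ y) →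
                  filter P? xs ≡ x ∷ y ∷ [] ⊎ filter P? xs ≡ y ∷ x ∷ []
  filter-≡-pair {x} {y} {z ∷ zs} u@(_ ∷ u′) x∈ y∈ x≢y px py only = by-head (P? z)
    where
    tail : ∀ {w} → w ∈ z ∷ zs → w ≢ z → w ∈ zs
    tail (here w≡z) w≢z = contradiction w≡z w≢z
    tail (there w∈) _   = w∈

    by-head : Dec (P z) → filter P? (z ∷ zs) ≡ x ∷ y ∷ [] ⊎ filter P? (z ∷ zs) ≡ y ∷ x ∷ []
    by-head (no ¬pz) = Sum.map (trans (filter-reject P? ¬pz)) (trans (filter-reject P? ¬pz))
      (filter-≡-pair u′ (tail x∈ λ { refl → ¬pz px }) (tail y∈ λ { refl → ¬pz py }) x≢y px py (only ∘ there))
    by-head (yes pz) with only (here refl) pz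
    ... | inj₁ refl = inj₁ (filter-≡-head-pair u (tail y∈ (≢-sym x≢y)) px py only)
    ... | inj₂ refl = inj₂ (filter-≡-head-pair u (tail x∈ x≢y) py px (λ z∈ pz → Sum.swap (only z∈ pz)))

AllPairs-lookup : ∀ {A : Set} {R : Rel A 0ℓ} {xs} → AllPairs R xs →
                  ∀ {i j} → i Fin.< j → R (lookup xs i) (lookup xs j)
AllPairs-lookup (_ ∷ _)    {zero}  {zero}  ()
AllPairs-lookup (Rx ∷ _)   {zero}  {suc j} _         = All.lookup Rx (∈-lookup j)
AllPairs-lookup (_ ∷ _)    {suc _} {zero}  ()
AllPairs-lookup (_ ∷ Rxs)  {suc i} {suc j} (s≤s i<j) = AllPairs-lookup Rxs i<j

colourIndex : ∀ {K x} → 1 ≤ x × x ≤ K → Fin K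
colourIndex {x = suc x} (_ , x<K) = fromℕ< x<K

colourIndex-injective : ∀ {K x y} (p : 1 ≤ x × x ≤ K) (q : 1 ≤ y × y ≤ K) →
                        colourIndex p ≡ colourIndex q → x ≡ y
colourIndex-injective {x = suc _} {suc _} (_ , x<K) (_ , y<K) eq =
  cong suc (trans (sym (toℕ-fromℕ< x<K)) (trans (cong toℕ eq) (toℕ-fromℕ< y<K)))

distinct-colours≤ : ∀ {K} (h : ℕ → ℕ) → (∀ i → 1 ≤ h i × h i ≤ K) →
                    ∀ is → AllPairs (λ i j → h i ≢ h j) is → length is ≤ K
distinct-colours≤ {K} h inRange is distinct with length is ≤? K
... | yes ≤K = ≤K
... | no ≰K with pigeonhole (≰⇒> ≰K) (λ p → colourIndex (inRange (lookup is p)))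
...   | p , q , p<q , same =
  contradiction (colourIndex-injective (inRange _) (inRange _) same) (AllPairs-lookup distinct p<q)

HasQMNSD-mono : ∀ {G j K} → j ≤ K → HasQMNSD G j → HasQMNSD G K
HasQMNSD-mono j≤K ((c , inRange) , qm , nsd) =
  (c , λ e → proj₁ (inRange e) , ≤-trans (proj₂ (inRange e)) j≤K) , qm , nsd

ChiQMSigma≡-intro : ∀ G {k} → HasQMNSD G (suc k) → ¬ HasQMNSD G k → ChiQMSigma≡ G (suc k)
ChiQMSigma≡-intro _ has ¬has = has , λ j j<1+k hasj → ¬has (HasQMNSD-mono (s≤s⁻¹ j<1+k) hasj)

module _ {A : Set} (c : A → ℕ) where

  count-pair≤1 : ∀ {x y} a → c x ≢ c y → length (filter (λ e → c e ≟ a) (x ∷ y ∷ [])) ≤ 1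
  count-pair≤1 {x} {y} a cx≢cy = by-head (c x ≟ a)
    where
    by-head : Dec (c x ≡ a) → length (filter (λ e → c e ≟ a) (x ∷ y ∷ [])) ≤ 1
    by-head (yes cx≡a) = ≤-reflexive (cong length (trans (filter-accept (λ e → c e ≟ a) cx≡a)
      (cong (x ∷_) (filter-none (λ e → c e ≟ a) ((λ cy≡a → cx≢cy (trans cx≡a (sym cy≡a))) ∷ [])))))
    by-head (no cx≢a) = subst (_≤ 1) (cong length (sym (filter-reject (λ e → c e ≟ a) cx≢a)))
      (length-filter (λ e → c e ≟ a) (y ∷ []))

  count-pair≡2 : ∀ {x y a} → c x ≡ a → c y ≡ a → length (filter (λ e → c e ≟ a) (x ∷ y ∷ [])) ≡ 2
  count-pair≡2 cx≡a cy≡a = cong length (filter-all (λ e → c e ≟ _) (cx≡a ∷ cy≡a ∷ []))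

data LastOrInject : ∀ {n} → Fin (suc n) → Set where
  last   : ∀ {n} → LastOrInject (fromℕ n)
  inject : ∀ {n} (j : Fin n) → LastOrInject (inject₁ j)

lastOrInject : ∀ {n} (i : Fin (suc n)) → LastOrInject i
lastOrInject {zero}  zero    = last
lastOrInject {suc _} zero    = inject zero
lastOrInject {suc _} (suc i) with lastOrInject i
... | last     = last
... | inject j = inject (suc j)

-- colour i is the colour of the i-th edge met walking around C_N; closes₀ and closes₁ let
-- adjacent and skip constrain the last two edges against the first two.
record DistanceTwoColouring (N K : ℕ) (colour : ℕ → ℕ) : Set where
  field
    inRange  : ∀ i → 1 ≤ colour i × colour i ≤ K
    adjacent : ∀ i → colour i ≢ colour (1 + i)
    skip     : ∀ i → colour i ≢ colour (2 + i)
    closes₀  : colour N ≡ colour 0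
    closes₁  : colour (1 + N) ≡ colour 1

module Cycle (k : ℕ) where

  N : ℕ
  N = 2 + k

  G : Graph
  G = cycleGraph N

  next : Fin N → Fin N
  next e = proj₂ (ends G e)

  prev : Fin N → Fin N
  prev zero    = fromℕ (suc k)
  prev (suc j) = inject₁ j

  toℕ-next : ∀ e → toℕ (next e) ≡ suc (toℕ e) % N
  toℕ-next e = toℕ-fromℕ< (m%n<n (suc (toℕ e)) N)

  next-inject₁ : ∀ j → next (inject₁ j) ≡ suc j
  next-inject₁ j = toℕ-injective (begin
    toℕ (next (inject₁ j))      ≡⟨ toℕ-next (inject₁ j) ⟩
    suc (toℕ (inject₁ j)) % N   ≡⟨ cong (λ x → suc x % N) (toℕ-inject₁ j) ⟩
    suc (toℕ j) % N             ≡⟨ m<n⇒m%n≡m (s≤s (toℕ<n j)) ⟩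
    suc (toℕ j)                 ∎)
    where open ≡-Reasoning

  next-last : next (fromℕ (suc k)) ≡ zero
  next-last = toℕ-injective (begin
    toℕ (next (fromℕ (suc k)))     ≡⟨ toℕ-next (fromℕ (suc k)) ⟩
    suc (toℕ (fromℕ (suc k))) % N  ≡⟨ cong (λ x → suc x % N) (toℕ-fromℕ (suc k)) ⟩
    N % N                          ≡⟨ n%n≡0 N ⟩
    0                              ∎)
    where open ≡-Reasoning

  prev-next : ∀ e → prev (next e) ≡ e
  prev-next e with lastOrInject e
  ... | last     = cong prev next-last
  ... | inject j = cong prev (next-inject₁ j)

  next-prev : ∀ v → next (prev v) ≡ v
  next-prev zero    = next-last
  next-prev (suc j) = next-inject₁ j

  prev≢id : ∀ v → prev v ≢ v
  prev≢id zero    ()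
  prev≢id (suc j) eq = 1+n≢n (sym (trans (sym (toℕ-inject₁ j)) (cong toℕ eq)))

  incident⇒self⊎prev : ∀ {v e} → Incident G e v → e ≡ v ⊎ e ≡ prev v
  incident⇒self⊎prev (inj₁ e≡v)      = inj₁ e≡v
  incident⇒self⊎prev (inj₂ next-e≡v) = inj₂ (trans (sym (prev-next _)) (cong prev next-e≡v))

  incEdges-elim : ∀ (Q : List (Fin N) → Set) v →
                  Q (v ∷ prev v ∷ []) → Q (prev v ∷ v ∷ []) → Q (incEdges G v)
  incEdges-elim Q v q₁ q₂ =
    [ (λ eq → subst Q (sym eq) q₁) , (λ eq → subst Q (sym eq) q₂) ]′
      (filter-≡-pair (λ e → incident? G e v) (allFin⁺ N) (∈-allFin v) (∈-allFin (prev v))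
        (≢-sym (prev≢id v)) (inj₁ refl) (inj₂ (next-prev v)) (λ _ → incident⇒self⊎prev))

  module _ (c : Fin N → ℕ) where

    σ-cycle : ∀ v → σ G c v ≡ c v + c (prev v)
    σ-cycle v = incEdges-elim (λ es → sum (map c es) ≡ c v + c (prev v)) v
      (cong (c v +_) (+-identityʳ _))
      (trans (cong (c (prev v) +_) (+-identityʳ _)) (+-comm (c (prev v)) (c v)))

    σ-next : ∀ e → σ G c (next e) ≡ c e + c (next e)
    σ-next e = trans (σ-cycle (next e))
      (trans (cong (λ w → c (next e) + c w) (prev-next e)) (+-comm (c (next e)) (c e)))

    σ-ends≡⇔flanks≡ : ∀ e → σ G c e ≡ σ G c (next e) ⇔ c (prev e) ≡ c (next e)
    σ-ends≡⇔flanks≡ e = mk⇔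
      (λ eq → +-cancelˡ-≡ (c e) _ _ (trans (sym (σ-cycle e)) (trans eq (σ-next e))))
      (λ eq → trans (σ-cycle e) (trans (cong (c e +_) eq) (sym (σ-next e))))

    NSD⇔skip : NSD G c ⇔ (∀ e → c e ≢ c (next (next e)))
    NSD⇔skip = mk⇔
      (λ nsd e eq → nsd (next e) (from (σ-ends≡⇔flanks≡ (next e)) (trans (cong c (prev-next e)) eq)))
      (λ skip e eq → skip (prev e) (trans (to (σ-ends≡⇔flanks≡ e) eq) (cong (c ∘ next) (sym (next-prev e)))))

    degree-cycle : ∀ v → degree G v ≡ 2
    degree-cycle v = incEdges-elim (λ es → length es ≡ 2) v refl refl

    QM⇔colorCount≤1 : QM G c ⇔ (∀ v a → colorCount G c v a ≤ 1)
    QM⇔colorCount≤1 = mk⇔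
      (λ qm v a → subst (λ d → colorCount G c v a ≤ ceilHalf d) (degree-cycle v) (qm v a))
      (λ ≤1 v a → subst (λ d → colorCount G c v a ≤ ceilHalf d) (sym (degree-cycle v)) (≤1 v a))

    QM⇔adjacent : QM G c ⇔ (∀ e → c e ≢ c (next e))
    QM⇔adjacent = mk⇔
      (λ qm e eq → <⇒≱ ≤-refl (subst (_≤ 1) (colorCount≡2 e eq) (to QM⇔colorCount≤1 qm (next e) (c e))))
      (λ adjacent → from QM⇔colorCount≤1 λ v a →
        let cv≢cprev = λ eq → adjacent (prev v) (trans (sym eq) (cong c (sym (next-prev v)))) in
        incEdges-elim (λ es → length (filter (λ w → c w ≟ a) es) ≤ 1) v
          (count-pair≤1 c a cv≢cprev) (count-pair≤1 c a (≢-sym cv≢cprev)))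
      where
      colorCount≡2 : ∀ e → c e ≡ c (next e) → colorCount G c (next e) (c e) ≡ 2
      colorCount≡2 e eq = incEdges-elim (λ es → length (filter (λ w → c w ≟ c e) es) ≡ 2) (next e)
        (count-pair≡2 c (sym eq) (cong c (prev-next e)))
        (count-pair≡2 c (cong c (prev-next e)) (sym eq))

  walk : ℕ → Fin N
  walk zero    = zero
  walk (suc i) = next (walk i)

  toℕ-walk : ∀ i → i < N → toℕ (walk i) ≡ i
  toℕ-walk zero    _     = refl
  toℕ-walk (suc i) i+1<N = begin
    toℕ (next (walk i))      ≡⟨ toℕ-next (walk i) ⟩
    suc (toℕ (walk i)) % N   ≡⟨ cong (λ x → suc x % N) (toℕ-walk i (<⇒≤ i+1<N)) ⟩
    suc i % N                ≡⟨ m<n⇒m%n≡m i+1<N ⟩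
    suc i                    ∎
    where open ≡-Reasoning

  walk-closes : walk N ≡ zero
  walk-closes = trans (cong next (toℕ-injective (trans (toℕ-walk (suc k) ≤-refl) (sym (toℕ-fromℕ (suc k))))))
                      next-last

  closes-next : ∀ (h : ℕ → ℕ) → h N ≡ h 0 → ∀ e → h (toℕ (next e)) ≡ h (suc (toℕ e))
  closes-next h closes e with lastOrInject e
  ... | last     = trans (cong (h ∘ toℕ) next-last)
                         (trans (sym closes) (cong (h ∘ suc) (sym (toℕ-fromℕ (suc k)))))
  ... | inject j = trans (cong (h ∘ toℕ) (next-inject₁ j)) (cong (h ∘ suc) (sym (toℕ-inject₁ j)))

  hasQMNSD⇒distanceTwo : ∀ {K} → HasQMNSD G K → ∃ (DistanceTwoColouring N K)
  hasQMNSD⇒distanceTwo ((c , inRange) , qm , nsd) = c ∘ walk , record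
    { inRange  = inRange ∘ walk
    ; adjacent = to (QM⇔adjacent c) qm ∘ walk
    ; skip     = to (NSD⇔skip c) nsd ∘ walk
    ; closes₀  = cong c walk-closes
    ; closes₁  = cong (c ∘ next) walk-closes
    }

  distanceTwo⇒hasQMNSD : ∀ {K h} → DistanceTwoColouring N K h → HasQMNSD G K
  distanceTwo⇒hasQMNSD {h = h} χ =
    (h ∘ toℕ , inRange ∘ toℕ) , from (QM⇔adjacent (h ∘ toℕ)) adjacent′ , from (NSD⇔skip (h ∘ toℕ)) skip′
    where
    open DistanceTwoColouring χ
    adjacent′ : ∀ e → h (toℕ e) ≢ h (toℕ (next e))
    adjacent′ e eq = adjacent (toℕ e) (trans eq (closes-next h closes₀ e))
    skip′ : ∀ e → h (toℕ e) ≢ h (toℕ (next (next e)))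
    skip′ e eq = skip (toℕ e)
      (trans eq (trans (closes-next h closes₀ (next e)) (closes-next (h ∘ suc) closes₁ e)))

module _ {N K h} (χ : DistanceTwoColouring N K h) where
  open DistanceTwoColouring χ

  3≤K : 3 ≤ K
  3≤K = distinct-colours≤ h inRange (0 ∷ 1 ∷ 2 ∷ [])
    ((adjacent 0 ∷ skip 0 ∷ []) ∷ (adjacent 1 ∷ []) ∷ [] ∷ [])

module _ {N h} (χ : DistanceTwoColouring N 3 h) where
  open DistanceTwoColouring χ

  3-periodic : ∀ i → h (3 + i) ≡ h i
  3-periodic i with h (3 + i) ≟ h i
  ... | yes eq = eq
  ... | no neq = contradiction
    (distinct-colours≤ h inRange (i ∷ 1 + i ∷ 2 + i ∷ 3 + i ∷ [])
      ( (adjacent i ∷ skip i ∷ ≢-sym neq ∷ [])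
      ∷ (adjacent (1 + i) ∷ skip (1 + i) ∷ [])
      ∷ (adjacent (2 + i) ∷ [])
      ∷ [] ∷ []))
    (<⇒≱ ≤-refl)

  N%3≡0 : N % 3 ≡ 0
  N%3≡0 = remainder (N % 3) (m%n<n N 3) colour-remainder
    where
    periodic : ∀ t i → h (t * 3 + i) ≡ h i
    periodic zero    i = refl
    periodic (suc t) i = trans (3-periodic (t * 3 + i)) (periodic t i)

    colour-remainder : h (N % 3) ≡ h 0
    colour-remainder = begin
      h (N % 3)                  ≡⟨ sym (periodic (N / 3) (N % 3)) ⟩
      h (N / 3 * 3 + N % 3)      ≡⟨ cong h (+-comm (N / 3 * 3) (N % 3)) ⟩
      h (N % 3 + N / 3 * 3)      ≡⟨ cong h (sym (m≡m%n+[m/n]*n N 3)) ⟩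
      h N                        ≡⟨ closes₀ ⟩
      h 0                        ∎
      where open ≡-Reasoning

    remainder : ∀ r → r < 3 → h r ≡ h 0 → r ≡ 0
    remainder 0 _ _ = refl
    remainder 1 _ eq = contradiction (sym eq) (adjacent 0)
    remainder 2 _ eq = contradiction (sym eq) (skip 0)
    remainder (suc (suc (suc _))) (s≤s (s≤s (s≤s ()))) _

module _ {K h} (χ : DistanceTwoColouring 5 K h) where
  open DistanceTwoColouring χ

  -- Wrapping around, edges 5 and 6 are edges 0 and 1, so the pairs {0,3}, {0,4}, {1,4} are close too.
  5≤K : 5 ≤ K
  5≤K = distinct-colours≤ h inRange (0 ∷ 1 ∷ 2 ∷ 3 ∷ 4 ∷ [])
    ( (adjacent 0 ∷ skip 0 ∷ (λ eq → skip 3 (trans (sym eq) (sym closes₀)))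
                           ∷ (λ eq → adjacent 4 (trans (sym eq) (sym closes₀))) ∷ [])
    ∷ (adjacent 1 ∷ skip 1 ∷ (λ eq → skip 4 (trans (sym eq) (sym closes₁))) ∷ [])
    ∷ (adjacent 2 ∷ skip 2 ∷ [])
    ∷ (adjacent 3 ∷ [])
    ∷ [] ∷ [])

repeat123 : ℕ → ℕ
repeat123 0                   = 1
repeat123 1                   = 2
repeat123 2                   = 3
repeat123 (suc (suc (suc i))) = repeat123 i

repeat123-periodic : ∀ t i → repeat123 (t * 3 + i) ≡ repeat123 i
repeat123-periodic zero    i = refl
repeat123-periodic (suc t) i = repeat123-periodic t i

repeat123-colouring : ∀ {K} → 3 ≤ K → ∀ t → DistanceTwoColouring (t * 3) K repeat123
repeat123-colouring 3≤K t = record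
  { inRange  = inRange
  ; adjacent = adjacent
  ; skip     = skip
  ; closes₀  = trans (cong repeat123 (sym (+-identityʳ (t * 3)))) (repeat123-periodic t 0)
  ; closes₁  = trans (cong repeat123 (+-comm 1 (t * 3))) (repeat123-periodic t 1)
  }
  where
  inRange : ∀ i → 1 ≤ repeat123 i × repeat123 i ≤ _
  inRange 0                   = s≤s z≤n , ≤-trans (s≤s z≤n) 3≤K
  inRange 1                   = s≤s z≤n , ≤-trans (s≤s (s≤s z≤n)) 3≤K
  inRange 2                   = s≤s z≤n , 3≤K
  inRange (suc (suc (suc i))) = inRange i
  adjacent : ∀ i → repeat123 i ≢ repeat123 (1 + i)
  adjacent 0                   ()
  adjacent 1                   ()
  adjacent 2                   ()
  adjacent (suc (suc (suc i))) = adjacent i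
  skip : ∀ i → repeat123 i ≢ repeat123 (2 + i)
  skip 0                   ()
  skip 1                   ()
  skip 2                   ()
  skip (suc (suc (suc i))) = skip i

prepend1234 : (ℕ → ℕ) → ℕ → ℕ
prepend1234 h 0                         = 1
prepend1234 h 1                         = 2
prepend1234 h 2                         = 3
prepend1234 h 3                         = 4
prepend1234 h (suc (suc (suc (suc i)))) = h i

prepend1234-colouring : ∀ {N K h} → 4 ≤ K → h 0 ≡ 1 → h 1 ≡ 2 →
                        DistanceTwoColouring N K h → DistanceTwoColouring (4 + N) K (prepend1234 h)
prepend1234-colouring {N} {K} {h} 4≤K h0≡1 h1≡2 χ = record
  { inRange  = inRange′
  ; adjacent = adjacent′
  ; skip     = skip′
  ; closes₀  = trans closes₀ h0≡1
  ; closes₁  = trans closes₁ h1≡2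
  }
  where
  open DistanceTwoColouring χ
  inRange′ : ∀ i → 1 ≤ prepend1234 h i × prepend1234 h i ≤ K
  inRange′ 0                         = s≤s z≤n , ≤-trans (s≤s z≤n) 4≤K
  inRange′ 1                         = s≤s z≤n , ≤-trans (s≤s (s≤s z≤n)) 4≤K
  inRange′ 2                         = s≤s z≤n , ≤-trans (s≤s (s≤s (s≤s z≤n))) 4≤K
  inRange′ 3                         = s≤s z≤n , 4≤K
  inRange′ (suc (suc (suc (suc i)))) = inRange i
  adjacent′ : ∀ i → prepend1234 h i ≢ prepend1234 h (1 + i)
  adjacent′ 0                         ()
  adjacent′ 1                         ()
  adjacent′ 2                         ()
  adjacent′ 3                         eq = contradiction (trans eq h0≡1) λ ()
  adjacent′ (suc (suc (suc (suc i)))) = adjacent i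
  skip′ : ∀ i → prepend1234 h i ≢ prepend1234 h (2 + i)
  skip′ 0                         ()
  skip′ 1                         ()
  skip′ 2                         eq = contradiction (trans eq h0≡1) λ ()
  skip′ 3                         eq = contradiction (trans eq h1≡2) λ ()
  skip′ (suc (suc (suc (suc i)))) = skip i

repeat12345 : ℕ → ℕ
repeat12345 0                               = 1
repeat12345 1                               = 2
repeat12345 2                               = 3
repeat12345 3                               = 4
repeat12345 4                               = 5
repeat12345 (suc (suc (suc (suc (suc i))))) = repeat12345 i

repeat12345-colouring : DistanceTwoColouring 5 5 repeat12345
repeat12345-colouring = record
  { inRange  = inRange
  ; adjacent = adjacent
  ; skip     = skip
  ; closes₀  = refl
  ; closes₁  = refl
  }
  where
  inRange : ∀ i → 1 ≤ repeat12345 i × repeat12345 i ≤ 5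
  inRange 0                               = s≤s z≤n , s≤s z≤n
  inRange 1                               = s≤s z≤n , s≤s (s≤s z≤n)
  inRange 2                               = s≤s z≤n , s≤s (s≤s (s≤s z≤n))
  inRange 3                               = s≤s z≤n , s≤s (s≤s (s≤s (s≤s z≤n)))
  inRange 4                               = s≤s z≤n , ≤-refl
  inRange (suc (suc (suc (suc (suc i))))) = inRange i
  adjacent : ∀ i → repeat12345 i ≢ repeat12345 (1 + i)
  adjacent 0                               ()
  adjacent 1                               ()
  adjacent 2                               ()
  adjacent 3                               ()
  adjacent 4                               ()
  adjacent (suc (suc (suc (suc (suc i))))) = adjacent i
  skip : ∀ i → repeat12345 i ≢ repeat12345 (2 + i)
  skip 0                               ()
  skip 1                               ()
  skip 2                               ()
  skip 3                               ()
  skip 4                               ()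
  skip (suc (suc (suc (suc (suc i))))) = skip i

cycle-¬2 : ∀ k → ¬ HasQMNSD (cycleGraph (2 + k)) 2
cycle-¬2 k H = <⇒≱ ≤-refl (3≤K (proj₂ (Cycle.hasQMNSD⇒distanceTwo k H)))

cycle-¬3 : ∀ k → (2 + k) % 3 ≢ 0 → ¬ HasQMNSD (cycleGraph (2 + k)) 3
cycle-¬3 k ≢0 H = ≢0 (N%3≡0 (proj₂ (Cycle.hasQMNSD⇒distanceTwo k H)))

pentagon-¬4 : ¬ HasQMNSD (cycleGraph 5) 4
pentagon-¬4 H = <⇒≱ ≤-refl (5≤K (proj₂ (Cycle.hasQMNSD⇒distanceTwo 3 H)))

[3t+4]%3≢0 : ∀ t → (4 + t * 3) % 3 ≢ 0
[3t+4]%3≢0 t ≡0 = contradiction (trans (sym ([m+kn]%n≡m%n 1 (suc t) 3)) ≡0) λ ()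

[3t+8]%3≢0 : ∀ t → (8 + t * 3) % 3 ≢ 0
[3t+8]%3≢0 t ≡0 = contradiction (trans (sym ([m+kn]%n≡m%n 2 (2 + t) 3)) ≡0) λ ()

chi-3t+3 : ∀ t → ChiQMSigma≡ (cycleGraph (3 + t * 3)) 3
chi-3t+3 t = ChiQMSigma≡-intro (cycleGraph (3 + t * 3))
  (Cycle.distanceTwo⇒hasQMNSD (1 + t * 3) (repeat123-colouring ≤-refl (suc t)))
  (cycle-¬2 (1 + t * 3))

chi-3t+4 : ∀ t → ChiQMSigma≡ (cycleGraph (4 + t * 3)) 4
chi-3t+4 t = ChiQMSigma≡-intro (cycleGraph (4 + t * 3))
  (Cycle.distanceTwo⇒hasQMNSD (2 + t * 3)
    (prepend1234-colouring ≤-refl refl refl (repeat123-colouring (n≤1+n 3) t)))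
  (cycle-¬3 (2 + t * 3) ([3t+4]%3≢0 t))

chi-3t+8 : ∀ t → ChiQMSigma≡ (cycleGraph (8 + t * 3)) 4
chi-3t+8 t = ChiQMSigma≡-intro (cycleGraph (8 + t * 3))
  (Cycle.distanceTwo⇒hasQMNSD (6 + t * 3)
    (prepend1234-colouring ≤-refl refl refl
      (prepend1234-colouring ≤-refl refl refl (repeat123-colouring (n≤1+n 3) t))))
  (cycle-¬3 (6 + t * 3) ([3t+8]%3≢0 t))

chi-pentagon : ChiQMSigma≡ (cycleGraph 5) 5
chi-pentagon = ChiQMSigma≡-intro (cycleGraph 5)
  (Cycle.distanceTwo⇒hasQMNSD 3 repeat12345-colouring)
  pentagon-¬4

data CycleLength : ℕ → Set where
  3t+3     : ∀ t → CycleLength (3 + t * 3)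
  3t+4     : ∀ t → CycleLength (4 + t * 3)
  pentagon : CycleLength 5
  3t+8     : ∀ t → CycleLength (8 + t * 3)

cycleLength : ∀ n → 3 ≤ n → CycleLength n
cycleLength (suc zero)          (s≤s ())
cycleLength (suc (suc zero))    (s≤s (s≤s ()))
cycleLength (suc (suc (suc n))) _              = from-3+ n
  where
  from-3+ : ∀ n → CycleLength (3 + n)
  from-3+ 0 = 3t+3 0
  from-3+ 1 = 3t+4 0
  from-3+ 2 = pentagon
  from-3+ (suc (suc (suc n))) with from-3+ n
  ... | 3t+3 t   = 3t+3 (suc t)
  ... | 3t+4 t   = 3t+4 (suc t)
  ... | pentagon = 3t+8 0
  ... | 3t+8 t   = 3t+8 (suc t)

mainTheorem14 : ChiQMSigma≡ (cycleGraph 5) 5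
                × (∀ n → 3 ≤ n → n ≢ 5 →
                     (n % 3 ≡ 0 → ChiQMSigma≡ (cycleGraph n) 3)
                     × (n % 3 ≢ 0 → ChiQMSigma≡ (cycleGraph n) 4))
mainTheorem14 = chi-pentagon , other-lengths
  where
  other-lengths : ∀ n → 3 ≤ n → n ≢ 5 →
                  (n % 3 ≡ 0 → ChiQMSigma≡ (cycleGraph n) 3)
                  × (n % 3 ≢ 0 → ChiQMSigma≡ (cycleGraph n) 4)
  other-lengths n 3≤n n≢5 with cycleLength n 3≤n
  ... | 3t+3 t   = (λ _ → chi-3t+3 t) , λ ≢0 → contradiction (m*n%n≡0 (suc t) 3) ≢0
  ... | 3t+4 t   = (λ ≡0 → contradiction ≡0 ([3t+4]%3≢0 t)) , λ _ → chi-3t+4 t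
  ... | pentagon = contradiction refl n≢5
  ... | 3t+8 t   = (λ ≡0 → contradiction ≡0 ([3t+8]%3≢0 t)) , λ _ → chi-3t+8 t
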